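{- For all $i=2,3,\ldots$ it holds that $w(L_i)\ge (i-1)\,f_i(R)$.
   Context: $\mathcal{G}=(R\cup B,E)$ is a simple bipartite graph without isolated nodes (nodes in $R$ red, in $B$ blue); each node has a strict linear order (preference) on its neighbours. Consider the following synchronous distributed algorithm run in rounds $1,2,\dots$, each round being a blue turn followed by a red turn (messages sent in a turn are received in the next turn). Each blue $b$ keeps $p(b)$, initially $\bot$. Each red $r$ keeps a list $C(r)$, initially all neighbours of $r$ in decreasing preference, and $c(r)=\bot$, $p(r)=\bot$. Blue turn, for each $b$: let $P$ be the set of neighbours that sent `propose'; if $P=\emptyset$ do nothing; else let $Q=P\cup\{p(b)\}$ if $p(b)\ne\bot$ and $Q=P$ otherwise, let $q$ be $b$'s most preferred node in $Q$; if $q\ne p(b)$ then send `break' to $p(b)$ (if $p(b)\neq\bot$), send `accept' to $q$ and set $p(b)\gets q$; send `reject' to every $r\in P\setminus\{q\}$. Red turn, for each $r$: (1) if $c(r)\ne\bot$: receive message $m$ from $c(r)$; if $m$=`accept' set $p(r)\gets c(r)$; if $m$=`reject' remove $c(r)$ from $C(r)$; set $c(r)\gets\bot$. (2) if $p(r)\ne\bot$ and $r$ receives `break' from $p(r)$: remove $p(r)$ from $C(r)$ and set $p(r)\gets\bot$. (3) if $p(r)=\bot$ and $C(r)\ne\emptyset$: set $c(r)$ to the first element of $C(r)$ and send `propose' to it. A subscript $i$ denotes the value of a variable at the end of round $i$. An edge $\{r,b\}$ ($r\in R$, $b\in B$) is lost by the end of round $i$ if $b$ was removed from $C(r)$ in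 one of rounds $1,\dots,i$; $L_i\subseteq E$ is the set of such edges. Let $w:E\to\mathbb{Z}_{>0}$ be weights respecting preferences: whenever a node $v$ prefers $x$ over $y$, $w(\{v,x\})\ge w(\{v,y\})$; for $S\subseteq E$, $w(S)=\sum_{e\in S}w(e)$. For $r\in R$, the potential $f_i(r)$ is $0$ if $p_i(r)\ne\bot$ or $C_i(r)$ is empty, and otherwise $f_i(r)=w(\{r,b\})$ where $b$ is the first element of $C_i(r)$; $f_i(R)=\sum_{r\in R}f_i(r)$. -}

module Defs where

open import Data.Nat using (ℕ; zero; suc; _+_; _≤_)
open import Data.Bool using (Bool; true; false; _∧_; _∨_; not; if_then_else_)
open import Data.Fin using (Fin; _≟_)
open import Data.List using (List; []; _∷_; _++_; filter; allFin; upTo; map)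
open import Data.Bool.ListAction using (any)
open import Data.Nat.ListAction using (sum)
open import Data.List.Membership.Propositional using (_∈_)
open import Data.List.Relation.Unary.Unique.Propositional using (Unique)
open import Data.Maybe using (Maybe; just; nothing; is-just)
open import Data.Maybe.Properties using (≡-dec)
open import Data.Product using (Σ; _×_; ∃₂)
open import Relation.Binary.PropositionalEquality using (_≡_; _≢_)
open import Relation.Nullary using (¬?)
open import Relation.Nullary.Decidable using (⌊_⌋)

Before : {A : Set} → A → A → List A → Set
Before x y xs = ∃₂ λ as bs → (xs ≡ as ++ x ∷ bs) × (y ∈ bs)

-- The strict linear preference order of a node on its
-- neighbours is given by the list of its neighbours in DECREASING preference
-- (duplicate-free).  {r,b} is an edge iff b ∈ prefR r (iff r ∈ prefB b).
record PrefGraph (nR nB : ℕ) : Set where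
  field
    prefR : Fin nR → List (Fin nB)
    prefB : Fin nB → List (Fin nR)
    uniqueR : ∀ r → Unique (prefR r)
    uniqueB : ∀ b → Unique (prefB b)
    edgeRB : ∀ r b → b ∈ prefR r → r ∈ prefB b
    edgeBR : ∀ r b → r ∈ prefB b → b ∈ prefR r
    noIsolatedR : ∀ r → prefR r ≢ []
    noIsolatedB : ∀ b → prefB b ≢ []

-- weights w : E → ℤ_{>0} respecting preferences (w is given on all pairs,
-- only its values on edges matter)
record RespectingWeights {nR nB : ℕ} (G : PrefGraph nR nB)
                         (w : Fin nR → Fin nB → ℕ) : Set where
  open PrefGraph G
  field
    positive : ∀ r b → b ∈ prefR r → 1 ≤ w r b
    respectR : ∀ r x y → Before x y (prefR r) → w r y ≤ w r x
    respectB : ∀ b x y → Before x y (prefB b) → w y b ≤ w x b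

record State (nR nB : ℕ) : Set where
  field
    pB : Fin nB → Maybe (Fin nR)
    C  : Fin nR → List (Fin nB)
    c  : Fin nR → Maybe (Fin nB)
    pR : Fin nR → Maybe (Fin nB)

eqM : ∀ {n} → Maybe (Fin n) → Maybe (Fin n) → Bool
eqM x y = ⌊ ≡-dec _≟_ x y ⌋

eqF : ∀ {n} → Fin n → Fin n → Bool
eqF x y = ⌊ x ≟ y ⌋

memB : ∀ {n} → Fin n → List (Fin n) → Bool
memB x xs = any (eqF x) xs

remove : ∀ {n} → Fin n → List (Fin n) → List (Fin n)
remove x xs = filter (λ y → ¬? (y ≟ x)) xs

firstSat : {A : Set} → (A → Bool) → List A → Maybe A
firstSat p [] = nothing
firstSat p (x ∷ xs) = if p x then just x else firstSat p xs

module Algorithm {nR nB : ℕ} (G : PrefGraph nR nB) where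
  open PrefGraph G

  initState : State nR nB
  initState = record
    { pB = λ _ → nothing ; C = prefR ; c = λ _ → nothing ; pR = λ _ → nothing }

  module Round (s : State nR nB) where
    open State s

    -- blue turn: proposals received by b are from the reds r with c(r) = b
    inP : Fin nB → Fin nR → Bool
    inP b r = eqM (c r) (just b)

    inQ : Fin nB → Fin nR → Bool
    inQ b r = inP b r ∨ eqM (pB b) (just r)

    -- q(b): b's most preferred node of Q (nothing if P = ∅, i.e. b does nothing)
    qb : Fin nB → Maybe (Fin nR)
    qb b = if any (inP b) (allFin nR) then firstSat (inQ b) (prefB b) else nothing

    acceptMsg : Fin nB → Fin nR → Bool
    acceptMsg b r = eqM (qb b) (just r) ∧ not (eqM (pB b) (just r))

    rejectMsg : Fin nB → Fin nR → Bool
    rejectMsg b r = inP b r ∧ is-just (qb b) ∧ not (eqM (qb b) (just r))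

    breakMsg : Fin nB → Fin nR → Bool
    breakMsg b r = eqM (pB b) (just r) ∧ is-just (qb b) ∧ not (eqM (qb b) (just r))

    pB' : Fin nB → Maybe (Fin nR)
    pB' b with qb b
    ... | just q  = just q
    ... | nothing = pB b

    C1 : Fin nR → List (Fin nB)
    C1 r with c r
    ... | just b  = if rejectMsg b r then remove b (C r) else C r
    ... | nothing = C r

    p1 : Fin nR → Maybe (Fin nB)
    p1 r with c r
    ... | just b  = if acceptMsg b r then just b else pR r
    ... | nothing = pR r

    C2 : Fin nR → List (Fin nB)
    C2 r with p1 r
    ... | just b  = if breakMsg b r then remove b (C1 r) else C1 r
    ... | nothing = C1 r

    p2 : Fin nR → Maybe (Fin nB)
    p2 r with p1 r
    ... | just b  = if breakMsg b r then nothing else just b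
    ... | nothing = nothing

    -- step (3)  (after step (1), c(r) = ⊥)
    c3 : Fin nR → Maybe (Fin nB)
    c3 r with p2 r | C2 r
    ... | nothing | x ∷ _ = just x
    ... | _       | _     = nothing

    next : State nR nB
    next = record { pB = pB' ; C = C2 ; c = c3 ; pR = p2 }

  -- state at the end of round i (round 0 = initial state)
  state : ℕ → State nR nB
  state zero    = initState
  state (suc i) = Round.next (state i)

  Cat : ℕ → Fin nR → List (Fin nB)
  Cat i = State.C (state i)

  -- b removed from C(r) in round j+1
  removedIn : ℕ → Fin nR → Fin nB → Bool
  removedIn j r b = memB b (Cat j r) ∧ not (memB b (Cat (suc j) r))

  -- {r,b} ∈ L_i : removed in one of rounds 1..i
  lost : ℕ → Fin nR → Fin nB → Bool
  lost i r b = any (λ j → removedIn j r b) (upTo i)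

  module Weighted (w : Fin nR → Fin nB → ℕ) where
    wL : ℕ → ℕ
    wL i = sum (map (λ r → sum (map (λ b → if lost i r b then w r b else 0)
                                    (allFin nB))) (allFin nR))

    f : ℕ → Fin nR → ℕ
    f i r with State.pR (state i) r | State.C (state i) r
    ... | just _  | _     = 0
    ... | nothing | []    = 0
    ... | nothing | b ∷ _ = w r b

    fR : ℕ → ℕ
    fR i = sum (map (f i) (allFin nR))

module Submission where

-- Call a state coherent when every candidate list C(r) is a sublist of r's
-- preference list, a red with a pending proposal c(r) = b or a partner
-- p(r) = b (never both) has b at the head of C(r), and p(r) = b iff p(b) = r.
-- The initial state is coherent and every round preserves coherence; in a
-- coherent state each red does exactly one of five things in a round: its
-- proposal is accepted or rejected, it is broken up with, it keeps its
-- partner, or it idles.  After round 1 an idling red has an empty list.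
-- From this case analysis we get, for every round i + 1 with i ≥ 1:
--   (a) f_{i+1}(r) is at most the weight of the edges r loses in that round,
--       since only rejected or broken reds have positive potential, and
--       their new head is worse than the removed one;
--   (b) f_{i+1}(R) ≤ f_i(R): the new potential of a red broken by b is
--       charged to the red b accepted, whose old potential vanishes.
-- As L_{i+1} is L_i plus the edges lost in round i + 1, (a) gives
-- w(L_{i+1}) ≥ w(L_i) + f_{i+1}(R), and induction using (b) proves the lemma.

open import Defs
open import Data.Nat using (ℕ; zero; suc; _+_; _*_; _∸_; _≤_; z≤n; s≤s)
open import Data.Nat.Properties
  using (≤-refl; ≤-trans; ≤-reflexive; +-mono-≤; +-monoʳ-≤; *-monoʳ-≤; +-comm; +-identityʳ;
         m≤m+n; m≤n+m; m∸n+n≡m; +-cancelʳ-≤; +-0-commutativeMonoid; module ≤-Reasoning)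
open import Data.Bool using (Bool; true; false; _∧_; _∨_; not; if_then_else_)
open import Data.Bool.Properties using (∧-zeroʳ; ∨-identityʳ)
open import Data.Fin using (Fin; _≟_) renaming (zero to fzero; suc to fsuc)
open import Data.Fin.Properties using (suc-injective)
open import Data.List using (List; []; _∷_; _++_; allFin; upTo; map; tabulate; [_])
open import Data.List.Properties using (map-tabulate; upTo-∷ʳ)
open import Data.Bool.ListAction using (any)
open import Data.Nat.ListAction using (sum)
open import Data.List.Membership.Propositional using (_∈_; _∉_)
open import Data.List.Membership.Propositional.Properties using (∈-allFin; ∈-filter⁻; ∈-upTo⁻)
open import Data.List.Relation.Unary.Any using (here; there)
open import Data.List.Relation.Binary.Sublist.Propositional using (_⊆_; _∷_; _∷ʳ_; ⊆-refl; ⊆-trans; lookup)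
open import Data.List.Relation.Binary.Sublist.Propositional.Properties using (filter-⊆)
open import Algebra.Properties.CommutativeMonoid.Sum +-0-commutativeMonoid
  using (∑-distrib-+; ∑-comm; sum-cong-≗; sum-replicate-zero) renaming (sum to ∑)
open import Data.Maybe using (Maybe; just; nothing)
open import Data.Maybe.Properties using (≡-dec; just-injective)
open import Data.Product using (∃; _×_; _,_; proj₁; proj₂)
open import Data.Sum using (_⊎_; inj₁; inj₂)
open import Data.Empty using (⊥-elim)
open import Relation.Binary.PropositionalEquality using (_≡_; _≢_; refl; sym; trans; cong; subst; module ≡-Reasoning)
open import Relation.Nullary using (¬_; ¬?; Dec; yes; no; contradiction)
open import Relation.Nullary.Decidable using (⌊_⌋; isYes≗does; dec-true; dec-false)

if-true : {A : Set} {t : Bool} {x y : A} → t ≡ true → (if t then x else y) ≡ x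
if-true refl = refl

if-false : {A : Set} {t : Bool} {x y : A} → t ≡ false → (if t then x else y) ≡ y
if-false refl = refl

∧-true : {a b : Bool} → a ∧ b ≡ true → a ≡ true × b ≡ true
∧-true {true} e = refl , e

∨-true : {a b : Bool} → a ∨ b ≡ true → a ≡ true ⊎ b ≡ true
∨-true {true}  _ = inj₁ refl
∨-true {false} e = inj₂ e

not-true : {a : Bool} → not a ≡ true → a ≡ false
not-true {false} _ = refl

⌊⌋-sound : {A : Set} (d : Dec A) → ⌊ d ⌋ ≡ true → A
⌊⌋-sound (yes a) _ = a

⌊⌋-yes : {A : Set} (d : Dec A) → A → ⌊ d ⌋ ≡ true
⌊⌋-yes d a = trans (isYes≗does d) (dec-true d a)

⌊⌋-no : {A : Set} (d : Dec A) → ¬ A → ⌊ d ⌋ ≡ false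
⌊⌋-no d ¬a = trans (isYes≗does d) (dec-false d ¬a)

eqM-sound : ∀ {n} {x y : Maybe (Fin n)} → eqM x y ≡ true → x ≡ y
eqM-sound {x = x} {y} = ⌊⌋-sound (≡-dec _≟_ x y)

eqM-refl : ∀ {n} (x : Maybe (Fin n)) → eqM x x ≡ true
eqM-refl x = ⌊⌋-yes (≡-dec _≟_ x x) refl

eqM-false : ∀ {n} {x y : Maybe (Fin n)} → x ≢ y → eqM x y ≡ false
eqM-false {x = x} {y} = ⌊⌋-no (≡-dec _≟_ x y)

just≢ : ∀ {n} {x y : Fin n} → x ≢ y → just x ≢ just y
just≢ ne e = ne (just-injective e)

any-∈⁺ : {A : Set} (p : A → Bool) {x : A} {xs : List A} → x ∈ xs → p x ≡ true → any p xs ≡ true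
any-∈⁺ p {xs = y ∷ ys} (here refl) e rewrite e = refl
any-∈⁺ p {xs = y ∷ ys} (there m) e with p y
... | true  = refl
... | false = any-∈⁺ p m e

any-∈⁻ : {A : Set} (p : A → Bool) (xs : List A) → any p xs ≡ true → ∃ λ x → x ∈ xs × p x ≡ true
any-∈⁻ p (y ∷ ys) e with p y in py
... | true  = y , here refl , py
... | false with any-∈⁻ p ys e
...   | x , m , px = x , there m , px

any-++ : {A : Set} (p : A → Bool) (xs ys : List A) → any p (xs ++ ys) ≡ any p xs ∨ any p ys
any-++ p []       ys = refl
any-++ p (x ∷ xs) ys with p x
... | true  = refl
... | false = any-++ p xs ys

any-false : {A : Set} (p : A → Bool) (xs : List A) → (∀ x → x ∈ xs → p x ≡ false) → any p xs ≡ false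
any-false p []       none = refl
any-false p (x ∷ xs) none rewrite none x (here refl) = any-false p xs (λ y m → none y (there m))

memB-sound : ∀ {n} {x : Fin n} {xs : List (Fin n)} → memB x xs ≡ true → x ∈ xs
memB-sound {x = x} {xs} e with any-∈⁻ (eqF x) xs e
... | y , m , eq with ⌊⌋-sound (x ≟ y) eq
...   | refl = m

memB-complete : ∀ {n} {x : Fin n} {xs : List (Fin n)} → x ∈ xs → memB x xs ≡ true
memB-complete {x = x} m = any-∈⁺ (eqF x) m (⌊⌋-yes (x ≟ x) refl)

memB-false : ∀ {n} {x : Fin n} {xs : List (Fin n)} → x ∉ xs → memB x xs ≡ false
memB-false {x = x} {xs} x∉ with memB x xs in e
... | true  = ⊥-elim (x∉ (memB-sound e))
... | false = refl

remove-⊆ : ∀ {n} (x : Fin n) (xs : List (Fin n)) → remove x xs ⊆ xs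
remove-⊆ x = filter-⊆ (λ y → ¬? (y ≟ x))

remove-∉ : ∀ {n} (x : Fin n) (xs : List (Fin n)) → x ∉ remove x xs
remove-∉ x xs m = proj₂ (∈-filter⁻ (λ y → ¬? (y ≟ x)) {xs = xs} m) refl

remove-head : ∀ {n} {x y : Fin n} (xs : List (Fin n)) → y ∈ remove x (x ∷ xs) → y ∈ xs
remove-head {x = x} xs m with ∈-filter⁻ (λ y → ¬? (y ≟ x)) {xs = x ∷ xs} m
... | here y≡x , y≢x = ⊥-elim (y≢x y≡x)
... | there m′ , _   = m′

⊆-Before : {A : Set} {x y : A} {rest ys : List A} → (x ∷ rest) ⊆ ys → y ∈ rest → Before x y ys
⊆-Before (z ∷ʳ τ) m with ⊆-Before τ m
... | as , bs , eq , y∈bs = z ∷ as , bs , cong (z ∷_) eq , y∈bs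
⊆-Before {ys = _ ∷ ys} (refl ∷ τ) m = [] , ys , refl , lookup τ m

firstSat-sat : {A : Set} (p : A → Bool) (xs : List A) {q : A} → firstSat p xs ≡ just q → p q ≡ true
firstSat-sat p (y ∷ ys) e with p y in py
firstSat-sat p (y ∷ ys) refl | true = py
... | false = firstSat-sat p ys e

firstSat-exists : {A : Set} (p : A → Bool) {x : A} {xs : List A} → x ∈ xs → p x ≡ true → ∃ λ q → firstSat p xs ≡ just q
firstSat-exists p {xs = y ∷ ys} (here refl) px rewrite px = y , refl
firstSat-exists p {xs = y ∷ ys} (there m) px with p y
... | true  = y , refl
... | false = firstSat-exists p m px

firstSat-Before : {A : Set} (p : A → Bool) (xs : List A) {q x : A} → firstSat p xs ≡ just q →
                  p x ≡ true → x ∈ xs → x ≢ q → Before q x xs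
firstSat-Before p (y ∷ ys) e px m x≢q with p y in py
firstSat-Before p (y ∷ ys) refl px (here refl) x≢q | true = ⊥-elim (x≢q refl)
firstSat-Before p (y ∷ ys) refl px (there m)   x≢q | true = [] , ys , refl , m
firstSat-Before p (y ∷ ys) e    px (here refl) x≢q | false with () ← trans (sym px) py
firstSat-Before p (y ∷ ys) e    px (there m)   x≢q | false with firstSat-Before p ys e px m x≢q
... | as , bs , eq , x∈bs = y ∷ as , bs , cong (y ∷_) eq , x∈bs

sum-allFin : ∀ n (h : Fin n → ℕ) → sum (map h (allFin n)) ≡ ∑ h
sum-allFin n h = trans (cong sum (map-tabulate (λ x → x) h)) (go n h)
  where
  go : ∀ n (h : Fin n → ℕ) → sum (tabulate h) ≡ ∑ h
  go zero    h = refl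
  go (suc n) h = cong (h fzero +_) (go n (λ x → h (fsuc x)))

∑-mono : ∀ {n} {g h : Fin n → ℕ} → (∀ x → g x ≤ h x) → ∑ g ≤ ∑ h
∑-mono {zero}  le = z≤n
∑-mono {suc n} le = +-mono-≤ (le fzero) (∑-mono (λ x → le (fsuc x)))

∑-zero : ∀ {n} (h : Fin n → ℕ) → (∀ x → h x ≡ 0) → ∑ h ≡ 0
∑-zero {n} h h≡0 = trans (sum-cong-≗ h≡0) (sum-replicate-zero n)

∑-term : ∀ {n} (h : Fin n → ℕ) (x : Fin n) → h x ≤ ∑ h
∑-term h fzero    = m≤m+n (h fzero) _
∑-term h (fsuc x) = ≤-trans (∑-term (λ y → h (fsuc y)) x) (m≤n+m _ (h fzero))

∑-atMostOne : ∀ {n} (P : Fin n → Bool) (c : ℕ) → (∀ x y → P x ≡ true → P y ≡ true → x ≡ y) →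
              ∑ (λ x → if P x then c else 0) ≤ c
∑-atMostOne {zero}  P c unique = z≤n
∑-atMostOne {suc n} P c unique with P fzero in p0
... | true  = ≤-reflexive (trans (cong (c +_) (∑-zero _ rest-zero)) (+-identityʳ c))
  where
  rest-zero : ∀ x → (if P (fsuc x) then c else 0) ≡ 0
  rest-zero x with P (fsuc x) in px
  ... | true  with () ← unique fzero (fsuc x) p0 px
  ... | false = refl
... | false = ∑-atMostOne (λ x → P (fsuc x)) c
                (λ x y px py → suc-injective (unique (fsuc x) (fsuc y) px py))

-- One round: coherence, the five outcomes of a red, and preservation of coherence.

module RoundAnalysis {nR nB : ℕ} (G : PrefGraph nR nB) where
  open PrefGraph G
  open Algorithm G

  record Coherent (s : State nR nB) : Set where
    open State s
    field
      C⊆pref         : ∀ r → C r ⊆ prefR r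
      proposal-head  : ∀ r b → c r ≡ just b → pR r ≡ nothing × ∃ λ rest → C r ≡ b ∷ rest
      partner-head   : ∀ r b → pR r ≡ just b → c r ≡ nothing × ∃ λ rest → C r ≡ b ∷ rest
      partner-of-red : ∀ r b → pB b ≡ just r → pR r ≡ just b
      partner-of-blue : ∀ r b → pR r ≡ just b → pB b ≡ just r

  initial-coherent : Coherent initState
  initial-coherent = record
    { C⊆pref = λ r → ⊆-refl ; proposal-head = λ _ _ () ; partner-head = λ _ _ ()
    ; partner-of-red = λ _ _ () ; partner-of-blue = λ _ _ () }

  Settled : State nR nB → Set
  Settled s = ∀ r → State.pR s r ≡ nothing → State.c s r ≡ nothing → State.C s r ≡ []

  module InRound (s : State nR nB) where
    open State s
    open Round s

    C1-on : Fin nR → Maybe (Fin nB) → List (Fin nB)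
    C1-on r (just b) = if rejectMsg b r then remove b (C r) else C r
    C1-on r nothing  = C r

    p1-on : Fin nR → Maybe (Fin nB) → Maybe (Fin nB)
    p1-on r (just b) = if acceptMsg b r then just b else pR r
    p1-on r nothing  = pR r

    C2-on : Fin nR → Maybe (Fin nB) → List (Fin nB)
    C2-on r (just b) = if breakMsg b r then remove b (C1 r) else C1 r
    C2-on r nothing  = C1 r

    p2-on : Fin nR → Maybe (Fin nB) → Maybe (Fin nB)
    p2-on r (just b) = if breakMsg b r then nothing else just b
    p2-on r nothing  = nothing

    -- Defs defines the red turn by with-abstraction; these equations evaluate it.
    C1-unfold : ∀ r → C1 r ≡ C1-on r (c r)
    C1-unfold r with c r
    ... | just _  = refl
    ... | nothing = refl

    p1-unfold : ∀ r → p1 r ≡ p1-on r (c r)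
    p1-unfold r with c r
    ... | just _  = refl
    ... | nothing = refl

    C2-unfold : ∀ r → C2 r ≡ C2-on r (p1 r)
    C2-unfold r with p1 r
    ... | just _  = refl
    ... | nothing = refl

    p2-unfold : ∀ r → p2 r ≡ p2-on r (p1 r)
    p2-unfold r with p1 r
    ... | just _  = refl
    ... | nothing = refl

    p1-proposing : ∀ {r b} → c r ≡ just b → p1 r ≡ (if acceptMsg b r then just b else pR r)
    p1-proposing {r} e = trans (p1-unfold r) (cong (p1-on r) e)

    C1-proposing : ∀ {r b} → c r ≡ just b → C1 r ≡ (if rejectMsg b r then remove b (C r) else C r)
    C1-proposing {r} e = trans (C1-unfold r) (cong (C1-on r) e)

    p1-waiting : ∀ {r} → c r ≡ nothing → p1 r ≡ pR r
    p1-waiting {r} e = trans (p1-unfold r) (cong (p1-on r) e)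

    C1-waiting : ∀ {r} → c r ≡ nothing → C1 r ≡ C r
    C1-waiting {r} e = trans (C1-unfold r) (cong (C1-on r) e)

    p2-matched : ∀ {r b} → p1 r ≡ just b → p2 r ≡ (if breakMsg b r then nothing else just b)
    p2-matched {r} e = trans (p2-unfold r) (cong (p2-on r) e)

    C2-matched : ∀ {r b} → p1 r ≡ just b → C2 r ≡ (if breakMsg b r then remove b (C1 r) else C1 r)
    C2-matched {r} e = trans (C2-unfold r) (cong (C2-on r) e)

    p2-unmatched : ∀ {r} → p1 r ≡ nothing → p2 r ≡ nothing
    p2-unmatched {r} e = trans (p2-unfold r) (cong (p2-on r) e)

    C2-unmatched : ∀ {r} → p1 r ≡ nothing → C2 r ≡ C1 r
    C2-unmatched {r} e = trans (C2-unfold r) (cong (C2-on r) e)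

    pB'-chosen : ∀ {b q} → qb b ≡ just q → pB' b ≡ just q
    pB'-chosen e rewrite e = refl

    pB'-silent : ∀ {b} → qb b ≡ nothing → pB' b ≡ pB b
    pB'-silent e rewrite e = refl

    c3-proposes : ∀ r x → c3 r ≡ just x → p2 r ≡ nothing × ∃ λ rest → C2 r ≡ x ∷ rest
    c3-proposes r x e with p2 r | C2 r
    c3-proposes r x refl | nothing | y ∷ rest = refl , rest , refl
    c3-proposes r x ()   | nothing | []
    c3-proposes r x ()   | just _  | []
    c3-proposes r x ()   | just _  | _ ∷ _

    c3-matched : ∀ r b → p2 r ≡ just b → c3 r ≡ nothing
    c3-matched r b e with p2 r | C2 r
    c3-matched r b refl | just _ | []    = refl
    c3-matched r b refl | just _ | _ ∷ _ = refl

    settled-next : Settled next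
    settled-next r e e′ with p2 r | C2 r
    settled-next r refl ()  | nothing | _ ∷ _
    settled-next r refl e′  | nothing | []   = refl

    qb-in-Q : ∀ b q → qb b ≡ just q → inQ b q ≡ true
    qb-in-Q b q e with any (inP b) (allFin nR)
    ... | true = firstSat-sat (inQ b) (prefB b) e
    qb-in-Q b q () | false

    qb-preferred : ∀ b q x → qb b ≡ just q → inQ b x ≡ true → x ∈ prefB b → x ≢ q → Before q x (prefB b)
    qb-preferred b q x e with any (inP b) (allFin nR)
    ... | true = firstSat-Before (inQ b) (prefB b) e
    qb-preferred b q x () | false

    proposal-in-P : ∀ b r → c r ≡ just b → inP b r ≡ true
    proposal-in-P b r e rewrite e = eqM-refl (just b)

    qb-exists : ∀ b r → c r ≡ just b → r ∈ prefB b → ∃ λ q → qb b ≡ just q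
    qb-exists b r e r∈ rewrite any-∈⁺ (inP b) (∈-allFin r) (proposal-in-P b r e) =
      firstSat-exists (inQ b) r∈ (cong (_∨ _) (proposal-in-P b r e))

    Q-cases : ∀ b r → inQ b r ≡ true → c r ≡ just b ⊎ pB b ≡ just r
    Q-cases b r e with ∨-true {inP b r} e
    ... | inj₁ x = inj₁ (eqM-sound x)
    ... | inj₂ y = inj₂ (eqM-sound y)

    partner-in-Q : ∀ b r → pB b ≡ just r → inQ b r ≡ true
    partner-in-Q b r e rewrite e | eqM-refl (just r) with inP b r
    ... | true  = refl
    ... | false = refl

    accepted-proposer : ∀ b r → acceptMsg b r ≡ true → c r ≡ just b
    accepted-proposer b r e with ∧-true {eqM (qb b) (just r)} e
    ... | chosen , new with Q-cases b r (qb-in-Q b r (eqM-sound chosen))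
    ...   | inj₁ proposed = proposed
    ...   | inj₂ partner with () ← trans (sym (not-true new)) (trans (cong (λ z → eqM z (just r)) partner) (eqM-refl (just r)))

    break-partner : ∀ b r → breakMsg b r ≡ true → pB b ≡ just r
    break-partner b r e = eqM-sound (proj₁ (∧-true e))

    accept-true : ∀ b r → qb b ≡ just r → pB b ≢ just r → acceptMsg b r ≡ true
    accept-true b r e ne rewrite e | eqM-refl (just r) | eqM-false ne = refl

    accept-false : ∀ b r q → qb b ≡ just q → q ≢ r → acceptMsg b r ≡ false
    accept-false b r q e ne rewrite e | eqM-false (just≢ ne) = refl

    reject-false : ∀ b r → qb b ≡ just r → rejectMsg b r ≡ false
    reject-false b r e rewrite e | eqM-refl (just r) with inP b r
    ... | true  = refl
    ... | false = refl

    reject-true : ∀ b r q → c r ≡ just b → qb b ≡ just q → q ≢ r → rejectMsg b r ≡ true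
    reject-true b r q ec e ne rewrite ec | eqM-refl (just b) | e | eqM-false (just≢ ne) = refl

    break-false : ∀ b r → pB b ≢ just r → breakMsg b r ≡ false
    break-false b r ne rewrite eqM-false ne = refl

    break-true : ∀ b r q → pB b ≡ just r → qb b ≡ just q → q ≢ r → breakMsg b r ≡ true
    break-true b r q e1 e2 ne rewrite e1 | e2 | eqM-refl (just r) | eqM-false (just≢ ne) = refl

    no-break-chosen : ∀ b r → qb b ≡ just r → breakMsg b r ≡ false
    no-break-chosen b r e rewrite e | eqM-refl (just r) with eqM (pB b) (just r)
    ... | true  = refl
    ... | false = refl

    no-break-silent : ∀ b r → qb b ≡ nothing → breakMsg b r ≡ false
    no-break-silent b r e rewrite e with eqM (pB b) (just r)
    ... | true  = refl
    ... | false = refl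

    breaker-chose : ∀ b r → breakMsg b r ≡ true → ∃ λ q → qb b ≡ just q × q ≢ r
    breaker-chose b r B = by-choice (qb b) refl
      where
      by-choice : ∀ m → qb b ≡ m → ∃ λ q → qb b ≡ just q × q ≢ r
      by-choice nothing  eq with () ← trans (sym B) (no-break-silent b r eq)
      by-choice (just q) eq with q ≟ r
      ... | yes refl with () ← trans (sym B) (no-break-chosen b q eq)
      ... | no q≢r = q , eq , q≢r

    data Outcome (r : Fin nR) : Set where
      accepted : ∀ b → c r ≡ just b → acceptMsg b r ≡ true →
                 p2 r ≡ just b → C2 r ≡ C r → Outcome r
      rejected : ∀ b → c r ≡ just b → acceptMsg b r ≡ false →
                 p2 r ≡ nothing → C2 r ≡ remove b (C r) → Outcome r
      broken   : ∀ b → c r ≡ nothing → pR r ≡ just b → breakMsg b r ≡ true →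
                 p2 r ≡ nothing → C2 r ≡ remove b (C r) → Outcome r
      kept     : ∀ b → c r ≡ nothing → pR r ≡ just b → breakMsg b r ≡ false →
                 p2 r ≡ just b → C2 r ≡ C r → Outcome r
      idle     : c r ≡ nothing → pR r ≡ nothing → p2 r ≡ nothing → C2 r ≡ C r → Outcome r

    module Coherence (coh : Coherent s) where
      open Coherent coh

      -- In a coherent state the head of C(r) is a neighbour of r, and a
      -- proposing red is single, hence not the partner of the blue it proposes to.
      head-in-pref : ∀ r {b rest} → C r ≡ b ∷ rest → r ∈ prefB b
      head-in-pref r {b} eC = edgeRB r b (lookup (C⊆pref r) (subst (b ∈_) (sym eC) (here refl)))

      proposer-not-partner : ∀ r b → c r ≡ just b → pB b ≢ just r
      proposer-not-partner r b ec e with () ← trans (sym (proj₁ (proposal-head r b ec))) (partner-of-red r b e)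

      partner-waits : ∀ r b → pR r ≡ just b → p1 r ≡ just b
      partner-waits r b ep = trans (p1-waiting (proj₁ (partner-head r b ep))) ep

      accepted-p2 : ∀ r b → c r ≡ just b → acceptMsg b r ≡ true → p2 r ≡ just b
      accepted-p2 r b ec A =
        trans (p2-matched (trans (p1-proposing ec) (if-true A))) (if-false (break-false b r (proposer-not-partner r b ec)))

      partner-p2 : ∀ r b → pR r ≡ just b → breakMsg b r ≡ false → p2 r ≡ just b
      partner-p2 r b ep B = trans (p2-matched (partner-waits r b ep)) (if-false B)

      proposal-outcome : ∀ r b → c r ≡ just b → Outcome r
      proposal-outcome r b ec with qb-exists b r ec (head-in-pref r (proj₂ (proj₂ (proposal-head r b ec))))
      ... | q , eq with q ≟ r
      ...   | yes refl = accepted b ec A (accepted-p2 q b ec A) C2≡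
        where
        A : acceptMsg b q ≡ true
        A = accept-true b q eq (proposer-not-partner q b ec)
        C2≡ : C2 q ≡ C q
        C2≡ = begin
          C2 q                                             ≡⟨ C2-matched (trans (p1-proposing ec) (if-true A)) ⟩
          (if breakMsg b q then remove b (C1 q) else C1 q) ≡⟨ if-false (break-false b q (proposer-not-partner q b ec)) ⟩
          C1 q                                             ≡⟨ C1-proposing ec ⟩
          (if rejectMsg b q then remove b (C q) else C q)  ≡⟨ if-false (reject-false b q eq) ⟩
          C q                                              ∎
          where open ≡-Reasoning
      ...   | no q≢r = rejected b ec A (p2-unmatched P1) C2≡
        where
        A : acceptMsg b r ≡ false
        A = accept-false b r q eq q≢r
        P1 : p1 r ≡ nothing
        P1 = trans (p1-proposing ec) (trans (if-false A) (proj₁ (proposal-head r b ec)))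
        C2≡ : C2 r ≡ remove b (C r)
        C2≡ = trans (C2-unmatched P1) (trans (C1-proposing ec) (if-true (reject-true b r q ec eq q≢r)))

      waiting-outcome : ∀ r → c r ≡ nothing → Outcome r
      waiting-outcome r ec with pR r in ep
      ... | nothing = idle ec ep (p2-unmatched P1) (trans (C2-unmatched P1) (C1-waiting ec))
        where
        P1 : p1 r ≡ nothing
        P1 = trans (p1-waiting ec) ep
      ... | just b with breakMsg b r in eb
      ...   | true  = broken b ec ep eb (trans (p2-matched P1) (if-true eb))
                        (trans (C2-matched P1) (trans (if-true eb) (cong (remove b) (C1-waiting ec))))
        where
        P1 : p1 r ≡ just b
        P1 = trans (p1-waiting ec) ep
      ...   | false = kept b ec ep eb (partner-p2 r b ep eb)
                        (trans (C2-matched P1) (trans (if-false eb) (C1-waiting ec)))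
        where
        P1 : p1 r ≡ just b
        P1 = trans (p1-waiting ec) ep

      outcome : ∀ r → Outcome r
      outcome r with c r in ec
      ... | just b  = proposal-outcome r b ec
      ... | nothing = waiting-outcome r ec

      next-partner-head : ∀ r b → p2 r ≡ just b → c3 r ≡ nothing × ∃ λ rest → C2 r ≡ b ∷ rest
      next-partner-head r b e with outcome r
      ... | accepted b′ ec _ P2 C2≡ with just-injective (trans (sym P2) e)
      ...   | refl = c3-matched r b e , rest , trans C2≡ eC
        where
        rest = proj₁ (proj₂ (proposal-head r b ec))
        eC = proj₂ (proj₂ (proposal-head r b ec))
      next-partner-head r b e | kept b′ _ ep _ P2 C2≡ with just-injective (trans (sym P2) e)
      ...   | refl = c3-matched r b e , rest , trans C2≡ eC
        where
        rest = proj₁ (proj₂ (partner-head r b ep))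
        eC = proj₂ (proj₂ (partner-head r b ep))
      next-partner-head r b e | rejected _ _ _ P2 _   with () ← trans (sym P2) e
      next-partner-head r b e | broken _ _ _ _ P2 _   with () ← trans (sym P2) e
      next-partner-head r b e | idle _ _ P2 _         with () ← trans (sym P2) e

      next-partner-of-red : ∀ r b → pB' b ≡ just r → p2 r ≡ just b
      next-partner-of-red r b e = by-choice (qb b) refl
        where
        by-choice : ∀ m → qb b ≡ m → p2 r ≡ just b
        by-choice nothing eq =
          partner-p2 r b (partner-of-red r b (trans (sym (pB'-silent eq)) e)) (no-break-silent b r eq)
        by-choice (just q) eq with just-injective (trans (sym (pB'-chosen eq)) e)
        ... | refl with Q-cases b r (qb-in-Q b r eq)
        ...   | inj₁ ec  = accepted-p2 r b ec (accept-true b r eq (proposer-not-partner r b ec))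
        ...   | inj₂ pBr = partner-p2 r b (partner-of-red r b pBr) (no-break-chosen b r eq)

      next-partner-of-blue : ∀ r b → p2 r ≡ just b → pB' b ≡ just r
      next-partner-of-blue r b e with outcome r
      ... | accepted b′ _ A P2 _ with just-injective (trans (sym P2) e)
      ...   | refl = pB'-chosen (eqM-sound (proj₁ (∧-true A)))
      next-partner-of-blue r b e | kept b′ _ ep B P2 _ with just-injective (trans (sym P2) e)
      ...   | refl = by-choice (qb b) refl
        where
        by-choice : ∀ m → qb b ≡ m → pB' b ≡ just r
        by-choice nothing eq = trans (pB'-silent eq) (partner-of-blue r b ep)
        by-choice (just q) eq with q ≟ r
        ... | yes refl = pB'-chosen eq
        ... | no q≢r with () ← trans (sym B) (break-true b r q (partner-of-blue r b ep) eq q≢r)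
      next-partner-of-blue r b e | rejected _ _ _ P2 _ with () ← trans (sym P2) e
      next-partner-of-blue r b e | broken _ _ _ _ P2 _ with () ← trans (sym P2) e
      next-partner-of-blue r b e | idle _ _ P2 _       with () ← trans (sym P2) e

      C2⊆C : ∀ r → C2 r ⊆ C r
      C2⊆C r with outcome r
      ... | accepted _ _ _ _ C2≡   = subst (_⊆ C r) (sym C2≡) ⊆-refl
      ... | rejected b _ _ _ C2≡   = subst (_⊆ C r) (sym C2≡) (remove-⊆ b (C r))
      ... | broken b _ _ _ _ C2≡   = subst (_⊆ C r) (sym C2≡) (remove-⊆ b (C r))
      ... | kept _ _ _ _ _ C2≡     = subst (_⊆ C r) (sym C2≡) ⊆-refl
      ... | idle _ _ _ C2≡         = subst (_⊆ C r) (sym C2≡) ⊆-refl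

      coherent-next : Coherent next
      coherent-next = record
        { C⊆pref = λ r → ⊆-trans (C2⊆C r) (C⊆pref r)
        ; proposal-head = c3-proposes
        ; partner-head = next-partner-head
        ; partner-of-red = next-partner-of-red
        ; partner-of-blue = next-partner-of-blue
        }

-- The potential f and the two estimates (a) and (b) for one round.

module PotentialAnalysis {nR nB : ℕ} (G : PrefGraph nR nB) (w : Fin nR → Fin nB → ℕ)
                         (RW : RespectingWeights G w) where
  open PrefGraph G
  open RespectingWeights RW
  open Algorithm G
  open RoundAnalysis G

  headWeight : Fin nR → Maybe (Fin nB) → List (Fin nB) → ℕ
  headWeight r (just _) _       = 0
  headWeight r nothing  []      = 0
  headWeight r nothing  (b ∷ _) = w r b

  potential : State nR nB → Fin nR → ℕ
  potential s r = headWeight r (State.pR s r) (State.C s r)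

  headWeight-≤ : ∀ r m l k → (∀ x → x ∈ l → w r x ≤ k) → headWeight r m l ≤ k
  headWeight-≤ r (just _) l       k bound = z≤n
  headWeight-≤ r nothing  []      k bound = z≤n
  headWeight-≤ r nothing  (x ∷ l) k bound = bound x (here refl)

  -- A round starting from a coherent, settled state: the state at the end of any round i ≥ 1.
  module Estimates (s : State nR nB) (coh : Coherent s) (settled : Settled s) where
    open State s
    open Round s
    open InRound s
    open Coherence coh
    open Coherent coh

    -- A proposing red is single, with the proposed-to blue at the head of its list.
    proposer-potential : ∀ r b → c r ≡ just b → potential s r ≡ w r b
    proposer-potential r b ec
      rewrite proj₁ (proposal-head r b ec) | proj₂ (proj₂ (proposal-head r b ec)) = refl

    -- A red that loses the head b of its list ends the round with potential at most w(r,b),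
    -- since its remaining candidates are less preferred than b.
    after-losing-head : ∀ r b rest → C r ≡ b ∷ rest → C2 r ≡ remove b (C r) → potential next r ≤ w r b
    after-losing-head r b rest eC C2≡ = headWeight-≤ r (p2 r) (C2 r) (w r b) λ x x∈ →
      respectR r b x (⊆-Before (subst (_⊆ prefR r) eC (C⊆pref r))
                               (remove-head {x = b} rest (subst (x ∈_) (trans C2≡ (cong (remove b) eC)) x∈)))

    -- Matched reds, and idle reds (whose lists are exhausted), end the round with potential 0.
    matched-potential : ∀ r b → p2 r ≡ just b → potential next r ≡ 0
    matched-potential r b P2 rewrite P2 = refl

    idle-potential : ∀ r → c r ≡ nothing → pR r ≡ nothing → p2 r ≡ nothing → C2 r ≡ C r → potential next r ≡ 0
    idle-potential r ec ep P2 C2≡ rewrite P2 | C2≡ | settled r ep ec = refl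

    vanishes : ∀ {r k} → potential next r ≡ 0 → potential next r ≤ k
    vanishes {k = k} e = subst (_≤ k) (sym e) z≤n

    -- Estimate (a): the new potential is paid for by the weight of the edges lost in the round.
    lostWeight : Fin nR → ℕ
    lostWeight r = ∑ λ b → if memB b (C r) ∧ not (memB b (C2 r)) then w r b else 0

    losing-head-bound : ∀ r b rest → C r ≡ b ∷ rest → C2 r ≡ remove b (C r) → potential next r ≤ lostWeight r
    losing-head-bound r b rest eC C2≡ = begin
      potential next r                                          ≤⟨ after-losing-head r b rest eC C2≡ ⟩
      w r b                                                     ≡⟨ sym (if-true lost-b) ⟩
      (if memB b (C r) ∧ not (memB b (C2 r)) then w r b else 0) ≤⟨ ∑-term _ b ⟩
      lostWeight r                                              ∎
      where
      open ≤-Reasoning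
      lost-b : memB b (C r) ∧ not (memB b (C2 r)) ≡ true
      lost-b rewrite memB-complete {x = b} {xs = C r} (subst (b ∈_) (sym eC) (here refl))
                   | memB-false {x = b} {xs = C2 r} (λ m → remove-∉ b (C r) (subst (b ∈_) C2≡ m)) = refl

    potential-≤-lost : ∀ r → potential next r ≤ lostWeight r
    potential-≤-lost r with outcome r
    ... | accepted b _ _ P2 _    = vanishes (matched-potential r b P2)
    ... | kept b _ _ _ P2 _      = vanishes (matched-potential r b P2)
    ... | idle ec ep P2 C2≡      = vanishes (idle-potential r ec ep P2 C2≡)
    ... | rejected b ec _ _ C2≡  = losing-head-bound r b _ (proj₂ (proj₂ (proposal-head r b ec))) C2≡
    ... | broken b _ ep _ _ C2≡  = losing-head-bound r b _ (proj₂ (proj₂ (partner-head r b ep))) C2≡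

    -- Estimate (b), by charging.  A blue b releases the old potential of the red
    -- it accepts; a red broken up with by b is charged what b released.
    released : Fin nB → ℕ
    released b = ∑ λ r → if acceptMsg b r then potential s r else 0

    charge : Fin nR → ℕ
    charge r = ∑ λ b → if breakMsg b r then released b else 0

    givenUp : Fin nR → ℕ
    givenUp r = ∑ λ b → if acceptMsg b r then potential s r else 0

    -- Only the blue a red proposed to can accept it.
    acceptor-unique : ∀ r b b′ → acceptMsg b r ≡ true → acceptMsg b′ r ≡ true → b ≡ b′
    acceptor-unique r b b′ A A′ = just-injective (trans (sym (accepted-proposer b r A)) (accepted-proposer b′ r A′))

    not-accepted : ∀ r → (∀ b → c r ≡ just b → acceptMsg b r ≡ false) → givenUp r ≡ 0
    not-accepted r refuse = ∑-zero _ vanish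
      where
      vanish : ∀ b → (if acceptMsg b r then potential s r else 0) ≡ 0
      vanish b with acceptMsg b r in A
      ... | true with () ← trans (sym A) (refuse b (accepted-proposer b r A))
      ... | false = refl

    waiting-not-accepted : ∀ r → c r ≡ nothing → givenUp r ≡ 0
    waiting-not-accepted r ec = not-accepted r (λ b e → contradiction (trans (sym ec) e) λ ())

    -- The blue that breaks up with r accepted a proposal from a red q it prefers to r,
    -- and q's old potential is w(q,b) ≥ w(r,b).
    broken-bound : ∀ r b → pR r ≡ just b → breakMsg b r ≡ true → w r b ≤ released b
    broken-bound r b ep B with breaker-chose b r B
    ... | q , eq , q≢r with Q-cases b q (qb-in-Q b q eq)
    ...   | inj₂ pBq with () ← q≢r (just-injective (trans (sym pBq) (break-partner b r B)))
    ...   | inj₁ cq = begin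
      w r b                                               ≤⟨ respectB b q r q-before-r ⟩
      w q b                                               ≡⟨ sym (proposer-potential q b cq) ⟩
      potential s q                                       ≡⟨ sym (if-true (accept-true b q eq (proposer-not-partner q b cq))) ⟩
      (if acceptMsg b q then potential s q else 0)        ≤⟨ ∑-term _ q ⟩
      released b                                          ∎
      where
      open ≤-Reasoning
      q-before-r : Before q r (prefB b)
      q-before-r = qb-preferred b q r eq (partner-in-Q b r (break-partner b r B))
                     (head-in-pref r (proj₂ (proj₂ (partner-head r b ep)))) (λ e → q≢r (sym e))

    charging : ∀ r → potential next r + givenUp r ≤ potential s r + charge r
    charging r with outcome r
    ... | accepted b _ _ P2 _ rewrite matched-potential r b P2 =
      ≤-trans (∑-atMostOne (λ b′ → acceptMsg b′ r) (potential s r) (λ x y → acceptor-unique r x y))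
              (m≤m+n _ _)
    ... | rejected b ec A _ C2≡ rewrite not-accepted r (λ b′ e → subst (λ x → acceptMsg x r ≡ false) (just-injective (trans (sym ec) e)) A)
                                      | +-identityʳ (potential next r) =
      ≤-trans (after-losing-head r b _ (proj₂ (proj₂ (proposal-head r b ec))) C2≡)
              (≤-trans (≤-reflexive (sym (proposer-potential r b ec))) (m≤m+n _ _))
    ... | broken b ec ep B _ C2≡ rewrite waiting-not-accepted r ec | +-identityʳ (potential next r) =
      ≤-trans (after-losing-head r b _ (proj₂ (proj₂ (partner-head r b ep))) C2≡)
              (≤-trans (broken-bound r b ep B)
                (≤-trans (≤-reflexive (sym (if-true B))) (≤-trans (∑-term _ b) (m≤n+m _ _))))
    ... | kept b ec _ _ P2 _ rewrite matched-potential r b P2 | waiting-not-accepted r ec = z≤n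
    ... | idle ec ep P2 C2≡ rewrite idle-potential r ec ep P2 C2≡ | waiting-not-accepted r ec = z≤n

    -- Each blue breaks up with at most one red, so the total charge is at most
    -- the total released potential, which is the total potential given up.
    total-charge : ∑ charge ≤ ∑ givenUp
    total-charge = begin
      ∑ charge                                                         ≡⟨ ∑-comm (λ r b → if breakMsg b r then released b else 0) ⟩
      ∑ (λ b → ∑ λ r → if breakMsg b r then released b else 0)         ≤⟨ ∑-mono (λ b → ∑-atMostOne (λ r → breakMsg b r) (released b) (breaks-one b)) ⟩
      ∑ released                                                       ≡⟨ ∑-comm (λ b r → if acceptMsg b r then potential s r else 0) ⟩
      ∑ givenUp                                                        ∎
      where
      open ≤-Reasoning
      breaks-one : ∀ b r r′ → breakMsg b r ≡ true → breakMsg b r′ ≡ true → r ≡ r′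
      breaks-one b r r′ B B′ = just-injective (trans (sym (break-partner b r B)) (break-partner b r′ B′))

    potential-nonincreasing : ∑ (potential next) ≤ ∑ (potential s)
    potential-nonincreasing = +-cancelʳ-≤ (∑ givenUp) _ _ (begin
      ∑ (potential next) + ∑ givenUp          ≡⟨ sym (∑-distrib-+ (potential next) givenUp) ⟩
      ∑ (λ r → potential next r + givenUp r)  ≤⟨ ∑-mono charging ⟩
      ∑ (λ r → potential s r + charge r)      ≡⟨ ∑-distrib-+ (potential s) charge ⟩
      ∑ (potential s) + ∑ charge              ≤⟨ +-monoʳ-≤ (∑ (potential s)) total-charge ⟩
      ∑ (potential s) + ∑ givenUp             ∎)
      where open ≤-Reasoning

module Accounting {nR nB : ℕ} (G : PrefGraph nR nB) (w : Fin nR → Fin nB → ℕ)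
                  (RW : RespectingWeights G w) where
  open Algorithm G
  open Weighted w
  open RoundAnalysis G
  open PotentialAnalysis G w RW

  coherent : ∀ i → Coherent (state i)
  coherent zero    = initial-coherent
  coherent (suc i) = InRound.Coherence.coherent-next (state i) (coherent i)

  settled : ∀ i → Settled (state (suc i))
  settled i = InRound.settled-next (state i)

  -- The estimates of round k + 2.
  module EstimatesAt (k : ℕ) = Estimates (state (suc k)) (coherent (suc k)) (settled k)

  f-potential : ∀ i r → f i r ≡ potential (state i) r
  f-potential i r with State.pR (state i) r | State.C (state i) r
  ... | just _  | _     = refl
  ... | nothing | []    = refl
  ... | nothing | _ ∷ _ = refl

  fR-∑ : ∀ i → fR i ≡ ∑ (potential (state i))
  fR-∑ i = trans (sum-allFin nR (f i)) (sum-cong-≗ (f-potential i))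

  Cat-later : ∀ k j r → Cat (k + j) r ⊆ Cat j r
  Cat-later zero    j r = ⊆-refl
  Cat-later (suc k) j r =
    ⊆-trans (InRound.Coherence.C2⊆C (state (k + j)) (coherent (k + j)) r) (Cat-later k j r)

  -- An edge removed in round i + 1 was still present in all earlier rounds, so not yet lost.
  removed-not-lost : ∀ i r b → removedIn i r b ≡ true → lost i r b ≡ false
  removed-not-lost i r b e = any-false (λ j → removedIn j r b) (upTo i) not-removed
    where
    b∈Ci : b ∈ Cat i r
    b∈Ci = memB-sound (proj₁ (∧-true e))
    not-removed : ∀ j → j ∈ upTo i → removedIn j r b ≡ false
    not-removed j j∈ rewrite memB-complete {x = b} {xs = Cat (suc j) r}
                               (lookup (Cat-later (i ∸ suc j) (suc j) r)
                                 (subst (λ t → b ∈ Cat t r) (sym (m∸n+n≡m (∈-upTo⁻ j∈))) b∈Ci))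
      = ∧-zeroʳ (memB b (Cat j r))

  lost-suc : ∀ i r b → lost (suc i) r b ≡ lost i r b ∨ removedIn i r b
  lost-suc i r b = begin
    any p (upTo (suc i))        ≡⟨ cong (any p) (sym (upTo-∷ʳ i)) ⟩
    any p (upTo i ++ [ i ])     ≡⟨ any-++ p (upTo i) [ i ] ⟩
    any p (upTo i) ∨ (p i ∨ false) ≡⟨ cong (any p (upTo i) ∨_) (∨-identityʳ (p i)) ⟩
    any p (upTo i) ∨ p i        ∎
    where
    open ≡-Reasoning
    p : ℕ → Bool
    p j = removedIn j r b

  lostWeightAt : ℕ → Fin nR → Fin nB → ℕ
  lostWeightAt i r b = if lost i r b then w r b else 0

  removedWeightAt : ℕ → Fin nR → Fin nB → ℕ
  removedWeightAt i r b = if removedIn i r b then w r b else 0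

  -- L_{i+1} contains L_i and the edges removed in round i + 1 (disjointly).
  lost-step : ∀ i r b → lostWeightAt i r b + removedWeightAt i r b ≤ lostWeightAt (suc i) r b
  lost-step i r b rewrite lost-suc i r b with removedIn i r b in e
  ... | true rewrite removed-not-lost i r b e = ≤-refl
  ... | false with lost i r b
  ...   | true  = ≤-reflexive (+-identityʳ _)
  ...   | false = z≤n

  wL-∑ : ∀ i → wL i ≡ ∑ λ r → ∑ λ b → lostWeightAt i r b
  wL-∑ i = trans (sum-allFin nR (λ r → sum (map (lostWeightAt i r) (allFin nB))))
                 (sum-cong-≗ (λ r → sum-allFin nB (lostWeightAt i r)))

  -- By estimate (a): w(L_{k+2}) ≥ w(L_{k+1}) + f_{k+2}(R).
  wL-step : ∀ k → wL (suc k) + fR (suc (suc k)) ≤ wL (suc (suc k))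
  wL-step k rewrite wL-∑ (suc k) | wL-∑ (suc (suc k)) | fR-∑ (suc (suc k)) = begin
    ∑ (λ r → ∑ (L (suc k) r)) + ∑ (potential (state (suc (suc k))))
      ≡⟨ sym (∑-distrib-+ (λ r → ∑ (L (suc k) r)) (potential (state (suc (suc k))))) ⟩
    ∑ (λ r → ∑ (L (suc k) r) + potential (state (suc (suc k))) r)
      ≤⟨ ∑-mono (λ r → +-monoʳ-≤ (∑ (L (suc k) r)) (EstimatesAt.potential-≤-lost k r)) ⟩
    ∑ (λ r → ∑ (L (suc k) r) + ∑ (removedWeightAt (suc k) r))
      ≡⟨ sum-cong-≗ (λ r → sym (∑-distrib-+ (L (suc k) r) (removedWeightAt (suc k) r))) ⟩
    ∑ (λ r → ∑ (λ b → L (suc k) r b + removedWeightAt (suc k) r b))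
      ≤⟨ ∑-mono (λ r → ∑-mono (lost-step (suc k) r)) ⟩
    ∑ (λ r → ∑ (L (suc (suc k)) r))
      ∎
    where
    open ≤-Reasoning
    L : ℕ → Fin nR → Fin nB → ℕ
    L = lostWeightAt

  -- By estimate (b): f_{k+2}(R) ≤ f_{k+1}(R).
  fR-step : ∀ k → fR (suc (suc k)) ≤ fR (suc k)
  fR-step k rewrite fR-∑ (suc (suc k)) | fR-∑ (suc k) = EstimatesAt.potential-nonincreasing k

  weighted-loss : ∀ k → k * fR (suc k) ≤ wL (suc k)
  weighted-loss zero    = z≤n
  weighted-loss (suc k) = begin
    fR (suc (suc k)) + k * fR (suc (suc k)) ≤⟨ +-monoʳ-≤ (fR (suc (suc k))) (*-monoʳ-≤ k (fR-step k)) ⟩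
    fR (suc (suc k)) + k * fR (suc k)       ≤⟨ +-monoʳ-≤ (fR (suc (suc k))) (weighted-loss k) ⟩
    fR (suc (suc k)) + wL (suc k)           ≡⟨ +-comm (fR (suc (suc k))) (wL (suc k)) ⟩
    wL (suc k) + fR (suc (suc k))           ≤⟨ wL-step k ⟩
    wL (suc (suc k))                        ∎
    where open ≤-Reasoning

lemma4 : {nR nB : ℕ} (G : PrefGraph nR nB) (w : Fin nR → Fin nB → ℕ) → RespectingWeights G w → (i : ℕ) → 2 ≤ i → (i ∸ 1) * Algorithm.Weighted.fR G w i ≤ Algorithm.Weighted.wL G w i
lemma4 G w RW (suc (suc k)) (s≤s (s≤s z≤n)) = Accounting.weighted-loss G w RW (suc k)
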